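{- For all positive integers $n,r$, let $E_{n,r}(x)=\sum_{w\in[r]^n}x^{\mathrm{des}(w)}$. Then $$x^nE_{n,r}(1/x)=\mathcal{S}_r\big(x(1+x+x^2+\cdots+x^{r-1})^{n+1}\big).$$
   Context: $[r]=\{1,\dots,r\}$. A descent of a word $w\in[r]^n$ is an index $i\in[n-1]$ with $w(i)\ge w(i+1)$, and $\mathrm{des}(w)$ is the number of descents. For a polynomial or formal power series $H(x)=\sum_{m\ge0}h_mx^m$, $\mathcal{S}_r(H(x))=\sum_{m\ge0}h_{rm}x^m$. -}

module Defs where

open import Data.Nat using (ℕ; zero; suc; _+_; _*_; _∸_; _≤_; _≤?_)
open import Data.Fin using (Fin)
open import Data.Vec using (Vec; []; _∷_)
open import Data.List using (List; []; _∷_; map; concatMap; allFin; sum; replicate; length; filter)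
open import Data.Bool using (Bool; true; false; if_then_else_)
open import Relation.Nullary.Decidable using (does)
open import Data.Fin.Properties using () renaming (_≤?_ to _≤?ᶠ_)
open import Data.Nat.Properties using (_≟_)

-- All words w ∈ [r]^n, letters encoded as Fin r (letter i+1 ↔ Fin index i).
words : (r n : ℕ) → List (Vec (Fin r) n)
words r zero    = [] ∷ []
words r (suc n) = concatMap (λ a → map (a ∷_) (words r n)) (allFin r)

des : {r n : ℕ} → Vec (Fin r) n → ℕ
des []              = 0
des (a ∷ [])        = 0
des (a ∷ (b ∷ w))   = (if does (b ≤?ᶠ a) then 1 else 0) + des (b ∷ w)

-- Polynomials with ℕ coefficients as coefficient functions ℕ → ℕ
-- (coefficient of x^m) and as finite coefficient lists (low degree first).
Poly : Set
Poly = List ℕ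

coeff : Poly → ℕ → ℕ
coeff []       m       = 0
coeff (c ∷ p)  zero    = c
coeff (c ∷ p)  (suc m) = coeff p m

_+ₚ_ : Poly → Poly → Poly
[]      +ₚ q       = q
p       +ₚ []      = p
(a ∷ p) +ₚ (b ∷ q) = (a + b) ∷ (p +ₚ q)

scale : ℕ → Poly → Poly
scale c = map (c *_)

_*ₚ_ : Poly → Poly → Poly
[]      *ₚ q = []
(a ∷ p) *ₚ q = scale a q +ₚ (0 ∷ (p *ₚ q))

_^ₚ_ : Poly → ℕ → Poly
p ^ₚ zero  = 1 ∷ []
p ^ₚ suc k = p *ₚ (p ^ₚ k)

X^ : ℕ → Poly
X^ k = replicate k 0 Data.List.++ (1 ∷ [])

E : (n r : ℕ) → Poly
E n r = Data.List.foldr _+ₚ_ [] (map (λ w → X^ (des w)) (words r n))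

-- coefficient function of x^n · P(1/x), valid for deg P ≤ n
-- (E_{n,r} has degree ≤ n - 1, so this is x^n E_{n,r}(1/x)).
reflectCoeff : ℕ → Poly → ℕ → ℕ
reflectCoeff n p k = if does (k ≤? n) then coeff p (n ∸ k) else 0

geom : ℕ → Poly
geom r = replicate r 1

-- 𝒮_r(H)(x) : coefficient of x^m is h_{r m}
sectionCoeff : ℕ → Poly → ℕ → ℕ
sectionCoeff r p m = coeff p (r * m)

{-# OPTIONS --safe #-}
module Submission where

-- Since des w + asc w = n − 1, where asc w counts the strict ascents of w ∈ [r]^n, the
-- coefficient of x^(m+1) in x^n E_{n,r}(1/x) is the number of words with m ascents.  Let
-- G = 1 + x + ⋯ + x^(r−1).  The words a ∷ v, v ∈ [r]^n, with d ascents are counted by the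
-- coefficient of x^(r d + a) in G^(n+1): multiplying by G sums the r consecutive coefficients
-- ending at r d + a, namely those at r d + b for b ≤ a and at r (d − 1) + b for b > a, and by
-- induction these count the tails b ∷ v according as a b is a descent or an ascent.  Summing
-- over the first letter a < r gives the coefficient of x^(r (m+1) − 1) in G^(n+1).

open import Defs
open import Data.Nat using (ℕ; zero; suc; _+_; _*_; _∸_; _≤_; _<_; _≥_; _≤?_; z≤n; s≤s; z<s)
open import Data.Nat.Properties
  using (+-identityʳ; *-identityˡ; *-identityʳ; *-zeroʳ; +-comm; +-assoc;
         ≤-refl; ≤-trans; ≤-reflexive; ≤-pred; <⇒≱; ≰⇒>; n≤1+n; m≤m+n; m≤n+m; m≤m*n;
         m+n∸n≡m; ∸-monoʳ-<; m≤n⇒∃[o]m+o≡n)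
open import Data.Nat.ListAction using (sum)
open import Data.Nat.ListAction.Properties using (sum-++)
open import Data.Nat.Tactic.RingSolver using (solve-∀)
open import Data.Fin using (Fin; toℕ) renaming (zero to fzero; suc to fsuc)
open import Data.Fin.Properties using (toℕ<n)
open import Data.Vec using (Vec; []; _∷_)
open import Data.List using (List; []; _∷_; _++_; map; concatMap; allFin; tabulate; foldr)
open import Data.List.Properties using (map-++; map-cong; map-∘; map-tabulate)
open import Data.Bool using (if_then_else_)
open import Data.Product using (_,_)
open import Relation.Nullary using (Dec; yes; no; does)
open import Relation.Nullary.Decidable using (dec-true; dec-false)
open import Relation.Binary.PropositionalEquality using (_≡_; refl; sym; trans; cong; cong₂)
open Relation.Binary.PropositionalEquality.≡-Reasoning

δ : ℕ → ℕ → ℕ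
δ zero    zero    = 1
δ zero    (suc _) = 0
δ (suc _) zero    = 0
δ (suc x) (suc y) = δ x y

δ-diag : ∀ x → δ x x ≡ 1
δ-diag zero    = refl
δ-diag (suc x) = δ-diag x

δ-< : ∀ {x y} → x < y → δ x y ≡ 0
δ-< {zero}  (s≤s _)       = refl
δ-< {suc x} (s≤s (s≤s p)) = δ-< (s≤s p)

δ-> : ∀ {x y} → y < x → δ x y ≡ 0
δ-> {y = zero}  (s≤s _)       = refl
δ-> {y = suc y} (s≤s (s≤s p)) = δ-> (s≤s p)

δ-∸ : ∀ n {x y} → x ≤ n → y ≤ n → δ (n ∸ x) (n ∸ y) ≡ δ x y
δ-∸ n       {zero}  {zero}  _         _         = δ-diag n
δ-∸ n       {zero}  {suc y} _         y<n       = δ-> (∸-monoʳ-< z<s y<n)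
δ-∸ n       {suc x} {zero}  x<n       _         = δ-< (∸-monoʳ-< z<s x<n)
δ-∸ (suc n) {suc x} {suc y} (s≤s x≤n) (s≤s y≤n) = δ-∸ n x≤n y≤n

Σ< : ℕ → (ℕ → ℕ) → ℕ
Σ< zero    T = 0
Σ< (suc n) T = Σ< n T + T n

Σ<-cong : ∀ n {T U : ℕ → ℕ} → (∀ i → i < n → T i ≡ U i) → Σ< n T ≡ Σ< n U
Σ<-cong zero    e = refl
Σ<-cong (suc n) e = cong₂ _+_ (Σ<-cong n (λ i i<n → e i (≤-trans i<n (n≤1+n n)))) (e n ≤-refl)

Σ<-zero : ∀ n → Σ< n (λ _ → 0) ≡ 0
Σ<-zero zero    = refl
Σ<-zero (suc n) = trans (+-identityʳ _) (Σ<-zero n)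

Σ<-+ : ∀ p q T → Σ< (p + q) T ≡ Σ< p T + Σ< q (λ i → T (p + i))
Σ<-+ p zero    T rewrite +-identityʳ p = sym (+-identityʳ _)
Σ<-+ p (suc q) T rewrite +-comm p (suc q) | +-comm q p =
  trans (cong (_+ T (p + q)) (Σ<-+ p q T)) (+-assoc (Σ< p T) _ _)

Σ<-suc : ∀ n T → Σ< (suc n) T ≡ T 0 + Σ< n (λ i → T (suc i))
Σ<-suc n T = Σ<-+ 1 n T

sum-map-zero : ∀ {A : Set} {F : A → ℕ} → (∀ x → F x ≡ 0) → ∀ xs → sum (map F xs) ≡ 0
sum-map-zero e []       = refl
sum-map-zero e (x ∷ xs) = cong₂ _+_ (e x) (sum-map-zero e xs)

sum-concatMap : ∀ {A B : Set} (F : B → ℕ) (g : A → List B) xs →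
  sum (map F (concatMap g xs)) ≡ sum (map (λ a → sum (map F (g a))) xs)
sum-concatMap F g []       = refl
sum-concatMap F g (x ∷ xs) = begin
  sum (map F (g x ++ concatMap g xs))             ≡⟨ cong sum (map-++ F (g x) _) ⟩
  sum (map F (g x) ++ map F (concatMap g xs))     ≡⟨ sum-++ (map F (g x)) _ ⟩
  sum (map F (g x)) + sum (map F (concatMap g xs)) ≡⟨ cong (sum (map F (g x)) +_) (sum-concatMap F g xs) ⟩
  sum (map F (g x)) + sum (map (λ a → sum (map F (g a))) xs) ∎

sum-tabulate : ∀ {n} {g : Fin n → ℕ} {T : ℕ → ℕ} → (∀ i → g i ≡ T (toℕ i)) → sum (tabulate g) ≡ Σ< n T
sum-tabulate {zero}          e = refl
sum-tabulate {suc n} {T = T} e = trans (cong₂ _+_ (e fzero) (sum-tabulate (λ i → e (fsuc i)))) (sym (Σ<-suc n T))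

sum-map-allFin : ∀ {n} {G : Fin n → ℕ} {T : ℕ → ℕ} → (∀ i → G i ≡ T (toℕ i)) → sum (map G (allFin n)) ≡ Σ< n T
sum-map-allFin {G = G} e = trans (cong sum (map-tabulate (λ i → i) G)) (sum-tabulate e)

sum-words-suc : ∀ r n (F : Vec (Fin r) (suc n) → ℕ) →
  sum (map F (words r (suc n))) ≡ sum (map (λ a → sum (map (λ v → F (a ∷ v)) (words r n))) (allFin r))
sum-words-suc r n F =
  trans (sum-concatMap F (λ a → map (a ∷_) (words r n)) (allFin r))
        (cong sum (map-cong (λ a → cong sum (sym (map-∘ (words r n)))) (allFin r)))

coeff-+ₚ : ∀ p q j → coeff (p +ₚ q) j ≡ coeff p j + coeff q j
coeff-+ₚ []      q       j       = refl
coeff-+ₚ (a ∷ p) []      j       = sym (+-identityʳ _)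
coeff-+ₚ (a ∷ p) (b ∷ q) zero    = refl
coeff-+ₚ (a ∷ p) (b ∷ q) (suc j) = coeff-+ₚ p q j

coeff-scale : ∀ c q j → coeff (scale c q) j ≡ c * coeff q j
coeff-scale c []      j       = sym (*-zeroʳ c)
coeff-scale c (x ∷ q) zero    = refl
coeff-scale c (x ∷ q) (suc j) = coeff-scale c q j

coeff-*ₚ-∷ : ∀ a p q j → coeff ((a ∷ p) *ₚ q) j ≡ a * coeff q j + coeff (0 ∷ (p *ₚ q)) j
coeff-*ₚ-∷ a p q j = trans (coeff-+ₚ (scale a q) _ j) (cong (_+ _) (coeff-scale a q j))

coeff-*ₚ-1 : ∀ p j → coeff (p *ₚ (1 ∷ [])) j ≡ coeff p j
coeff-*ₚ-1 []      j       = refl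
coeff-*ₚ-1 (a ∷ p) zero    = trans (+-identityʳ _) (*-identityʳ a)
coeff-*ₚ-1 (a ∷ p) (suc j) = coeff-*ₚ-1 p j

coeff-1-*ₚ : ∀ q j → coeff ((1 ∷ []) *ₚ q) j ≡ coeff q j
coeff-1-*ₚ q zero    = trans (coeff-*ₚ-∷ 1 [] q 0) (trans (+-identityʳ _) (*-identityˡ _))
coeff-1-*ₚ q (suc j) = trans (coeff-*ₚ-∷ 1 [] q (suc j)) (trans (+-identityʳ _) (*-identityˡ _))

coeff-X^1-*ₚ-zero : ∀ q → coeff (X^ 1 *ₚ q) 0 ≡ 0
coeff-X^1-*ₚ-zero q = coeff-*ₚ-∷ 0 (1 ∷ []) q 0

coeff-X^1-*ₚ-suc : ∀ q j → coeff (X^ 1 *ₚ q) (suc j) ≡ coeff q j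
coeff-X^1-*ₚ-suc q j = trans (coeff-*ₚ-∷ 0 (1 ∷ []) q (suc j)) (coeff-1-*ₚ q j)

coeff-X^ : ∀ k j → coeff (X^ k) j ≡ δ k j
coeff-X^ zero    zero    = refl
coeff-X^ zero    (suc j) = refl
coeff-X^ (suc k) zero    = refl
coeff-X^ (suc k) (suc j) = coeff-X^ k j

coeff-foldr-+ₚ : ∀ ps j → coeff (foldr _+ₚ_ [] ps) j ≡ sum (map (λ p → coeff p j) ps)
coeff-foldr-+ₚ []       j = refl
coeff-foldr-+ₚ (p ∷ ps) j = trans (coeff-+ₚ p _ j) (cong (coeff p j +_) (coeff-foldr-+ₚ ps j))

coeff-geom-< : ∀ {r j} → j < r → coeff (geom r) j ≡ 1
coeff-geom-< {suc r} {zero}  _         = refl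
coeff-geom-< {suc r} {suc j} (s≤s j<r) = coeff-geom-< j<r

coeff-geom-≥ : ∀ {r j} → r ≤ j → coeff (geom r) j ≡ 0
coeff-geom-≥ {zero}          _         = refl
coeff-geom-≥ {suc r} {suc j} (s≤s r≤j) = coeff-geom-≥ r≤j

coeff-geom-block : ∀ r d {a} → a < r → coeff (geom r) (r * d + a) ≡ δ 0 d
coeff-geom-block r zero    a<r rewrite *-zeroʳ r = coeff-geom-< a<r
coeff-geom-block r (suc d) _   = coeff-geom-≥ (≤-trans (m≤m*n r (suc d)) (m≤m+n _ _))

-- windowSum f j r = Σ_{t < r, t ≤ j} f (j − t): the r coefficients ending at j, cut off below 0.
windowSum : (ℕ → ℕ) → ℕ → ℕ → ℕ
windowSum f j       zero    = 0
windowSum f zero    (suc r) = f zero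
windowSum f (suc j) (suc r) = f (suc j) + windowSum f j r

coeff-geom-*ₚ : ∀ r q j → coeff (geom r *ₚ q) j ≡ windowSum (coeff q) j r
coeff-geom-*ₚ zero    q j       = refl
coeff-geom-*ₚ (suc r) q zero    = trans (coeff-*ₚ-∷ 1 (geom r) q 0) (trans (+-identityʳ _) (*-identityˡ _))
coeff-geom-*ₚ (suc r) q (suc j) =
  trans (coeff-*ₚ-∷ 1 (geom r) q (suc j)) (cong₂ _+_ (*-identityˡ _) (coeff-geom-*ₚ r q j))

windowSum-+ : ∀ f k p q → windowSum f (k + p) (p + q) ≡ Σ< p (λ i → f (k + suc i)) + windowSum f k q
windowSum-+ f k zero    q rewrite +-identityʳ k = refl
windowSum-+ f k (suc p) q rewrite +-comm k (suc p) | +-comm p k = begin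
  f (suc (k + p)) + windowSum f (k + p) (p + q)            ≡⟨ cong (f (suc (k + p)) +_) (windowSum-+ f k p q) ⟩
  f (suc (k + p)) + (Σ< p (λ i → f (k + suc i)) + W)       ≡⟨ sym (+-assoc (f (suc (k + p))) _ W) ⟩
  (f (suc (k + p)) + Σ< p (λ i → f (k + suc i))) + W       ≡⟨ cong (_+ W) (+-comm (f (suc (k + p))) _) ⟩
  (Σ< p (λ i → f (k + suc i)) + f (suc (k + p))) + W       ∎
  where W = windowSum f k q

windowSum-prefix : ∀ f k c → windowSum f k (suc k + c) ≡ Σ< (suc k) f
windowSum-prefix f zero    c = refl
windowSum-prefix f (suc k) c = trans (cong (f (suc k) +_) (windowSum-prefix f k c)) (+-comm (f (suc k)) _)

lowerBlock : (ℕ → ℕ) → ℕ → ℕ → ℕ → ℕ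
lowerBlock f r zero    b = 0
lowerBlock f r (suc d) b = f (r * d + b)

-- The entry of the length-r window ending at r d + a whose index is ≡ b (mod r), for b < r.
windowEntry : (ℕ → ℕ) → (r a d b : ℕ) → ℕ
windowEntry f r a d b = if does (b ≤? a) then f (r * d + b) else lowerBlock f r d b

windowEntry-≤ : ∀ f r {a} d {b} → b ≤ a → windowEntry f r a d b ≡ f (r * d + b)
windowEntry-≤ f r d {b} b≤a =
  cong (λ t → if t then f (r * d + b) else lowerBlock f r d b) (dec-true (_ ≤? _) b≤a)

windowEntry-> : ∀ f r {a} d {b} → a < b → windowEntry f r a d b ≡ lowerBlock f r d b
windowEntry-> f r d {b} a<b =
  cong (λ t → if t then f (r * d + b) else lowerBlock f r d b) (dec-false (_ ≤? _) (<⇒≱ a<b))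

windowSum-split : ∀ f {r} a c d → suc a + c ≡ r →
  windowSum f (r * d + a) r ≡ Σ< (suc a) (λ b → f (r * d + b)) + Σ< c (λ i → lowerBlock f r d (suc a + i))
windowSum-split f a c zero refl rewrite *-zeroʳ (suc a + c) =
  trans (windowSum-prefix f a c) (sym (trans (cong (Σ< (suc a) f +_) (Σ<-zero c)) (+-identityʳ _)))
windowSum-split f a c (suc d) refl = begin
  windowSum f (R * suc d + a) R                                      ≡⟨ cong (λ j → windowSum f j R) (shift d a c) ⟩
  windowSum f ((K + c) + suc a) (suc a + c)                          ≡⟨ windowSum-+ f (K + c) (suc a) c ⟩
  Σ< (suc a) (λ i → f ((K + c) + suc i)) + windowSum f (K + c) c
    ≡⟨ cong₂ _+_ (Σ<-cong (suc a) (λ i _ → cong f (top d a c i)))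
                 (trans (cong (windowSum f (K + c)) (sym (+-identityʳ c))) (windowSum-+ f K c 0)) ⟩
  Σ< (suc a) (λ i → f (R * suc d + i)) + (Σ< c (λ i → f (K + suc i)) + 0)
    ≡⟨ cong (Σ< (suc a) (λ i → f (R * suc d + i)) +_)
            (trans (+-identityʳ _) (Σ<-cong c (λ i _ → cong f (below d a c i)))) ⟩
  Σ< (suc a) (λ i → f (R * suc d + i)) + Σ< c (λ i → f (R * d + (suc a + i))) ∎
  where
  R = suc a + c
  K = R * d + a
  shift : ∀ d a c → (suc a + c) * suc d + a ≡ ((suc a + c) * d + a + c) + suc a
  shift = solve-∀
  top : ∀ d a c i → ((suc a + c) * d + a + c) + suc i ≡ (suc a + c) * suc d + i
  top = solve-∀
  below : ∀ d a c i → ((suc a + c) * d + a) + suc i ≡ (suc a + c) * d + (suc a + i)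
  below = solve-∀

Σ<-windowEntry : ∀ f a c d → let r = suc a + c in
  Σ< r (windowEntry f r a d) ≡ Σ< (suc a) (λ b → f (r * d + b)) + Σ< c (λ i → lowerBlock f r d (suc a + i))
Σ<-windowEntry f a c d =
  trans (Σ<-+ (suc a) c (windowEntry f (suc a + c) a d))
        (cong₂ _+_ (Σ<-cong (suc a) (λ b b≤a → windowEntry-≤ f (suc a + c) d (≤-pred b≤a)))
                   (Σ<-cong c (λ i _ → windowEntry-> f (suc a + c) d (m≤m+n (suc a) i))))

windowSum-blocks : ∀ f {r} a d → a < r → windowSum f (r * d + a) r ≡ Σ< r (windowEntry f r a d)
windowSum-blocks f a d a<r with m≤n⇒∃[o]m+o≡n a<r
... | c , refl = trans (windowSum-split f a c d refl) (sym (Σ<-windowEntry f a c d))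

asc : ∀ {r n} → Vec (Fin r) n → ℕ
asc []            = 0
asc (a ∷ [])      = 0
asc (a ∷ (b ∷ w)) = (if does (toℕ b ≤? toℕ a) then 0 else 1) + asc (b ∷ w)

des+asc : ∀ {r n} (a : Fin r) (v : Vec (Fin r) n) → des (a ∷ v) + asc (a ∷ v) ≡ n
des+asc a []      = refl
des+asc a (b ∷ v) = step (toℕ b ≤? toℕ a) (des+asc b v)
  where
  step : ∀ {P : Set} (D : Dec P) {x y n} → x + y ≡ n →
    ((if does D then 1 else 0) + x) + ((if does D then 0 else 1) + y) ≡ suc n
  step (yes _) e = cong suc e
  step (no _) {x} {y} e = trans (+-comm x (suc y)) (cong suc (trans (+-comm y x) e))

des≤ : ∀ {r n} (a : Fin r) (v : Vec (Fin r) n) → des (a ∷ v) ≤ n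
des≤ a v = ≤-trans (m≤m+n _ _) (≤-reflexive (des+asc a v))

asc≤ : ∀ {r n} (a : Fin r) (v : Vec (Fin r) n) → asc (a ∷ v) ≤ n
asc≤ a v = ≤-trans (m≤n+m _ _) (≤-reflexive (des+asc a v))

des≡∸asc : ∀ {r n} (a : Fin r) (v : Vec (Fin r) n) → des (a ∷ v) ≡ n ∸ asc (a ∷ v)
des≡∸asc a v = trans (sym (m+n∸n≡m (des (a ∷ v)) (asc (a ∷ v)))) (cong (_∸ asc (a ∷ v)) (des+asc a v))

countAsc : (r n d : ℕ) → ℕ
countAsc r n d = sum (map (λ w → δ (asc w) d) (words r n))

countHeadAsc : (r n : ℕ) → Fin r → ℕ → ℕ
countHeadAsc r n a d = sum (map (λ v → δ (asc (a ∷ v)) d) (words r n))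

countHeadAsc-∷ : ∀ r n f → (∀ b d → countHeadAsc r n b d ≡ f (r * d + toℕ b)) →
  ∀ a d b → sum (map (λ v → δ (asc (a ∷ b ∷ v)) d) (words r n)) ≡ windowEntry f r (toℕ a) d (toℕ b)
countHeadAsc-∷ r n f count a d b = step (toℕ b ≤? toℕ a) d
  where
  step : (D : Dec (toℕ b ≤ toℕ a)) → ∀ d →
    sum (map (λ v → δ ((if does D then 0 else 1) + asc (b ∷ v)) d) (words r n))
      ≡ (if does D then f (r * d + toℕ b) else lowerBlock f r d (toℕ b))
  step (yes _) d       = count b d
  step (no _)  zero    = sum-map-zero (λ _ → refl) (words r n)
  step (no _)  (suc d) = count b d

countHeadAsc-coeff : ∀ r n a d → countHeadAsc r n a d ≡ coeff (geom r ^ₚ suc n) (r * d + toℕ a)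
countHeadAsc-coeff r zero a d = begin
  δ 0 d + 0                                     ≡⟨ +-identityʳ _ ⟩
  δ 0 d                                         ≡⟨ sym (coeff-geom-block r d (toℕ<n a)) ⟩
  coeff (geom r) (r * d + toℕ a)                ≡⟨ sym (coeff-*ₚ-1 (geom r) _) ⟩
  coeff (geom r ^ₚ 1) (r * d + toℕ a)           ∎
countHeadAsc-coeff r (suc n) a d = begin
  countHeadAsc r (suc n) a d
    ≡⟨ sum-words-suc r n (λ w → δ (asc (a ∷ w)) d) ⟩
  sum (map (λ b → sum (map (λ v → δ (asc (a ∷ b ∷ v)) d) (words r n))) (allFin r))
    ≡⟨ sum-map-allFin (countHeadAsc-∷ r n h (λ b d → countHeadAsc-coeff r n b d) a d) ⟩
  Σ< r (windowEntry h r (toℕ a) d)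
    ≡⟨ sym (windowSum-blocks h (toℕ a) d (toℕ<n a)) ⟩
  windowSum h (r * d + toℕ a) r
    ≡⟨ sym (coeff-geom-*ₚ r (geom r ^ₚ suc n) _) ⟩
  coeff (geom r ^ₚ suc (suc n)) (r * d + toℕ a) ∎
  where h = coeff (geom r ^ₚ suc n)

coeff-E : ∀ n r j → coeff (E n r) j ≡ sum (map (λ w → δ (des w) j) (words r n))
coeff-E n r j = begin
  coeff (E n r) j
    ≡⟨ coeff-foldr-+ₚ (map (λ w → X^ (des w)) (words r n)) j ⟩
  sum (map (λ p → coeff p j) (map (λ w → X^ (des w)) (words r n)))
    ≡⟨ cong sum (sym (map-∘ (words r n))) ⟩
  sum (map (λ w → coeff (X^ (des w)) j) (words r n))
    ≡⟨ cong sum (map-cong (λ w → coeff-X^ (des w) j) (words r n)) ⟩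
  sum (map (λ w → δ (des w) j) (words r n)) ∎

reflectCoeff-≤ : ∀ {n k} p → k ≤ n → reflectCoeff n p k ≡ coeff p (n ∸ k)
reflectCoeff-≤ {n} {k} p k≤n = cong (λ t → if t then coeff p (n ∸ k) else 0) (dec-true (k ≤? n) k≤n)

reflectCoeff-> : ∀ {n k} p → n < k → reflectCoeff n p k ≡ 0
reflectCoeff-> {n} {k} p n<k = cong (λ t → if t then coeff p (n ∸ k) else 0) (dec-false (k ≤? n) (<⇒≱ n<k))

reflectCoeff-E-zero : ∀ r n → reflectCoeff (suc n) (E (suc n) r) 0 ≡ 0
reflectCoeff-E-zero r n = begin
  reflectCoeff (suc n) (E (suc n) r) 0                   ≡⟨ reflectCoeff-≤ (E (suc n) r) z≤n ⟩
  coeff (E (suc n) r) (suc n)                            ≡⟨ coeff-E (suc n) r (suc n) ⟩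
  sum (map (λ w → δ (des w) (suc n)) (words r (suc n))) ≡⟨ sum-map-zero tooMany (words r (suc n)) ⟩
  0                                                      ∎
  where
  tooMany : (w : Vec (Fin r) (suc n)) → δ (des w) (suc n) ≡ 0
  tooMany (a ∷ v) = δ-< (s≤s (des≤ a v))

reflectCoeff-E-suc : ∀ r n m → reflectCoeff (suc n) (E (suc n) r) (suc m) ≡ countAsc r (suc n) m
reflectCoeff-E-suc r n m with m ≤? n
... | yes m≤n = begin
  reflectCoeff (suc n) (E (suc n) r) (suc m)             ≡⟨ reflectCoeff-≤ (E (suc n) r) (s≤s m≤n) ⟩
  coeff (E (suc n) r) (n ∸ m)                            ≡⟨ coeff-E (suc n) r (n ∸ m) ⟩
  sum (map (λ w → δ (des w) (n ∸ m)) (words r (suc n))) ≡⟨ cong sum (map-cong reflect (words r (suc n))) ⟩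
  countAsc r (suc n) m                                   ∎
  where
  reflect : (w : Vec (Fin r) (suc n)) → δ (des w) (n ∸ m) ≡ δ (asc w) m
  reflect (a ∷ v) = trans (cong (λ x → δ x (n ∸ m)) (des≡∸asc a v)) (δ-∸ n (asc≤ a v) m≤n)
... | no m≰n =
  trans (reflectCoeff-> (E (suc n) r) (s≤s (≰⇒> m≰n))) (sym (sum-map-zero tooMany (words r (suc n))))
  where
  tooMany : (w : Vec (Fin r) (suc n)) → δ (asc w) m ≡ 0
  tooMany (a ∷ v) = δ-< (≤-trans (s≤s (asc≤ a v)) (≰⇒> m≰n))

countAsc-coeff : ∀ r n m → countAsc (suc r) (suc n) m ≡ coeff (geom (suc r) ^ₚ suc (suc n)) (suc r * m + r)
countAsc-coeff r n m = begin
  countAsc R (suc n) m                              ≡⟨ sum-words-suc R n (λ w → δ (asc w) m) ⟩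
  sum (map (λ a → countHeadAsc R n a m) (allFin R)) ≡⟨ sum-map-allFin (λ a → countHeadAsc-coeff R n a m) ⟩
  Σ< R (λ b → h (R * m + b))                        ≡⟨ sym (trans (windowSum-split h r 0 m (+-identityʳ R)) (+-identityʳ _)) ⟩
  windowSum h (R * m + r) R                         ≡⟨ sym (coeff-geom-*ₚ R (geom R ^ₚ suc n) _) ⟩
  coeff (geom R ^ₚ suc (suc n)) (R * m + r)         ∎
  where
  R = suc r
  h = coeff (geom R ^ₚ suc n)

lemma5p3 : (n r : ℕ) → n ≥ 1 → r ≥ 1 → (m : ℕ) →
    reflectCoeff n (E n r) m ≡ sectionCoeff r (X^ 1 *ₚ (geom r ^ₚ (n + 1))) m
lemma5p3 (suc n) (suc r) (s≤s z≤n) (s≤s z≤n) zero = begin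
  reflectCoeff (suc n) (E (suc n) (suc r)) 0 ≡⟨ reflectCoeff-E-zero (suc r) n ⟩
  0                                           ≡⟨ sym (coeff-X^1-*ₚ-zero Q) ⟩
  coeff (X^ 1 *ₚ Q) 0                         ≡⟨ cong (coeff (X^ 1 *ₚ Q)) (sym (*-zeroʳ (suc r))) ⟩
  sectionCoeff (suc r) (X^ 1 *ₚ Q) 0          ∎
  where Q = geom (suc r) ^ₚ (suc n + 1)
lemma5p3 (suc n) (suc r) (s≤s z≤n) (s≤s z≤n) (suc m) = begin
  reflectCoeff (suc n) (E (suc n) (suc r)) (suc m)    ≡⟨ reflectCoeff-E-suc (suc r) n m ⟩
  countAsc (suc r) (suc n) m                          ≡⟨ countAsc-coeff r n m ⟩
  coeff (geom (suc r) ^ₚ suc (suc n)) (suc r * m + r)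
    ≡⟨ cong₂ (λ k j → coeff (geom (suc r) ^ₚ k) j) (+-comm 1 (suc n)) (index r m) ⟩
  coeff (geom (suc r) ^ₚ (suc n + 1)) (m + r * suc m) ≡⟨ sym (coeff-X^1-*ₚ-suc (geom (suc r) ^ₚ (suc n + 1)) (m + r * suc m)) ⟩
  sectionCoeff (suc r) (X^ 1 *ₚ (geom (suc r) ^ₚ (suc n + 1))) (suc m) ∎
  where
  index : ∀ r m → suc r * m + r ≡ m + r * suc m
  index = solve-∀
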